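{- Consider an instance of Multistage Knapsack with $T=2$ time steps and its linear relaxation (LP-MK) (written with $z_i$ for $z_{1i}$). Let $\hat S=(\hat x,\hat z)$ be a feasible solution of (LP-MK) with $\hat z_i=1-|\hat x_{2i}-\hat x_{1i}|$ for every object $i$. If $\hat S$ is a basic solution of (LP-MK), then at most $4$ objects are fractional in $\hat S$, where an object $i$ is called fractional if at least one of $\hat x_{1i},\hat x_{2i},\hat z_i$ is not an integer.
   Context: Multistage Knapsack: given a time horizon $T\ge 1$, objects $N=\{1,\dots,n\}$, for each $t\in\{1,\dots,T\}$ and $i\in N$ a profit $p_{ti}$ and a weight $w_{ti}$, for each $t\in\{1,\dots,T-1\}$ and $i\in N$ a bonus $B_{ti}\ge 0$, and capacities $C_t$. (LP-MK) is the linear program with variables $x_{ti}\in[0,1]$ ($t=1,\dots,T$, $i\in N$) and $z_{ti}\in[0,1]$ ($t=1,\dots,T-1$, $i\in N$): maximize $\sum_{t=1}^T\sum_{i\in N}p_{ti}x_{ti}+\sum_{t=1}^{T-1}\sum_{i\in N}B_{ti}z_{ti}$ subject to $\sum_{i\in N}w_{ti}x_{ti}\le C_t$ for all $t$, $z_{ti}\le -x_{(t+1)i}+x_{ti}+1$ and $z_{ti}\le x_{(t+1)i}-x_{ti}+1$ for all $t\le T-1$, $i\in N$. A basic solution is a vertex (extreme point) of its feasible polyhedron, i.e. a feasible point that is not the midpoint of two distinct feasible points.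
   Formalization: The profits, weights, bonuses, capacities and the solution $\hat S$ are rational rather than real, and being a basic solution is tested against rational feasible points only. -}

module Defs where

open import Data.Nat using (ℕ; zero; suc)
open import Data.Fin using (Fin)
open import Data.Integer using (ℤ)
open import Data.Rational using (ℚ; 0ℚ; 1ℚ; ½; _+_; _*_; _-_; _≤_; _/_)
open import Data.Product using (Σ; ∃; ∃-syntax; _×_)
open import Data.Sum using (_⊎_)
open import Relation.Binary.PropositionalEquality using (_≡_)
open import Relation.Nullary using (¬_)

Σℚ : {n : ℕ} → (Fin n → ℚ) → ℚ
Σℚ {zero}  f = 0ℚ
Σℚ {suc n} f = f Fin.zero + Σℚ {n} (λ i → f (Fin.suc i))

record Instance (n : ℕ) : Set where
  field
    p₁ p₂ : Fin n → ℚ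
    w₁ w₂ : Fin n → ℚ
    B     : Fin n → ℚ
    B≥0   : (i : Fin n) → 0ℚ ≤ B i
    C₁ C₂ : ℚ

record Point (n : ℕ) : Set where
  constructor point
  field
    x₁ x₂ z : Fin n → ℚ

open Point public

InUnit : ℚ → Set
InUnit q = (0ℚ ≤ q) × (q ≤ 1ℚ)

Feasible : {n : ℕ} → Instance n → Point n → Set
Feasible {n} I S =
  ((i : Fin n) → InUnit (x₁ S i) × InUnit (x₂ S i) × InUnit (z S i))
  × (Σℚ (λ i → Instance.w₁ I i * x₁ S i) ≤ Instance.C₁ I)
  × (Σℚ (λ i → Instance.w₂ I i * x₂ S i) ≤ Instance.C₂ I)
  × ((i : Fin n) → (z S i ≤ (0ℚ - x₂ S i) + x₁ S i + 1ℚ)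
                 × (z S i ≤ x₂ S i - x₁ S i + 1ℚ))

SamePoint : {n : ℕ} → Point n → Point n → Set
SamePoint {n} S S' = (i : Fin n) →
  (x₁ S i ≡ x₁ S' i) × (x₂ S i ≡ x₂ S' i) × (z S i ≡ z S' i)

IsMidpoint : {n : ℕ} → Point n → Point n → Point n → Set
IsMidpoint {n} S S' S'' = (i : Fin n) →
    (x₁ S i ≡ ½ * (x₁ S' i + x₁ S'' i))
  × (x₂ S i ≡ ½ * (x₂ S' i + x₂ S'' i))
  × (z S i ≡ ½ * (z S' i + z S'' i))

Basic : {n : ℕ} → Instance n → Point n → Set
Basic I S = Feasible I S ×
  ((S' S'' : Point _) → Feasible I S' → Feasible I S'' →
     ¬ SamePoint S' S'' → ¬ IsMidpoint S S' S'')

IsInteger : ℚ → Set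
IsInteger q = ∃[ k ] (q ≡ k / 1)

Fractional : {n : ℕ} → Point n → Fin n → Set
Fractional S i = ¬ IsInteger (x₁ S i) ⊎ ¬ IsInteger (x₂ S i) ⊎ ¬ IsInteger (z S i)

{-# OPTIONS --safe #-}
-- Call an object open if x₁ or x₂ lies strictly between 0 and 1; at a point with
-- z = 1 - |x₂ - x₁|, objects that are not open are integral. An open object can be moved
-- by ±(d₁, d₂) ≠ 0 inside [0,1]² without changing the sign of x₂ - x₁, so that
-- z = 1 - |x₂ - x₁| is affine along the move. For three open objects the vectors
-- (w₁ d₁, w₂ d₂) ∈ ℚ² are linearly dependent; a small nontrivial dependence μ gives a
-- perturbation Δ = μ d that keeps both knapsack weights, and S is the midpoint of the
-- distinct feasible points S ± Δ. So a basic solution has at most two fractional objects.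
module Submission where

open import Defs
open import Data.Fin using (Fin)
open import Data.List using (List; length)
open import Data.List.Membership.Propositional using (_∈_)
open import Data.Product using (∃-syntax; _×_)
open import Data.Rational using (ℚ; 1ℚ; _-_; ∣_∣)
open import Relation.Binary.PropositionalEquality using (_≡_)

module Perturbation where
  open import Data.Nat using (zero; suc)
  open import Data.Fin using (zero; suc)
  open import Data.Product using (Σ-syntax; _,_; proj₁; proj₂)
  open import Data.Sum as Sum using (_⊎_; inj₁; inj₂; [_,_]′)
  open import Data.Integer using (0ℤ; 1ℤ)
  open import Data.Rational
    using (0ℚ; ½; _+_; _*_; -_; 1/_; _≤_; _<_; _⊓_; _≟_; NonZero; ≢-nonZero; positive; nonNegative)
  open import Data.Rational.Properties
  open import Data.Rational.Solver using (module +-*-Solver)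
  open import Function using (_∘_; _$_; flip)
  open import Relation.Nullary using (¬_; Dec; yes; no; contradiction)
  open import Relation.Nullary.Decidable using (_×-dec_; _⊎-dec_)
  open import Data.Empty using (⊥-elim)
  open import Relation.Binary.PropositionalEquality
    using (_≢_; refl; sym; trans; cong; cong₂; subst; subst₂; ≢-sym; module ≡-Reasoning)
  open +-*-Solver

  p≤∣p∣ : ∀ p → p ≤ ∣ p ∣
  p≤∣p∣ p with ≤-total 0ℚ p
  ... | inj₁ 0≤p = ≤-reflexive (sym (0≤p⇒∣p∣≡p 0≤p))
  ... | inj₂ p≤0 = ≤-trans p≤0 (0≤∣p∣ p)

  -p≤∣p∣ : ∀ p → - p ≤ ∣ p ∣
  -p≤∣p∣ p = subst (- p ≤_) (∣-p∣≡∣p∣ p) (p≤∣p∣ (- p))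

  ∣p∣≤q : ∀ {p q} → p ≤ q → - p ≤ q → ∣ p ∣ ≤ q
  ∣p∣≤q {p} p≤q -p≤q with ∣p∣≡p∨∣p∣≡-p p
  ... | inj₁ ∣p∣≡p  = subst (_≤ _) (sym ∣p∣≡p) p≤q
  ... | inj₂ ∣p∣≡-p = subst (_≤ _) (sym ∣p∣≡-p) -p≤q

  ∣p-q∣≡∣q-p∣ : ∀ p q → ∣ p - q ∣ ≡ ∣ q - p ∣
  ∣p-q∣≡∣q-p∣ p q = begin
    ∣ p - q ∣     ≡⟨ cong ∣_∣ (solve 2 (λ p q → p :- q := :- (q :- p)) refl p q) ⟩
    ∣ - (q - p) ∣ ≡⟨ ∣-p∣≡∣p∣ (q - p) ⟩
    ∣ q - p ∣     ∎
    where open ≡-Reasoning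

  ∣p+q+r∣≤∣p∣+∣q∣+∣r∣ : ∀ p q r → ∣ p + q + r ∣ ≤ ∣ p ∣ + ∣ q ∣ + ∣ r ∣
  ∣p+q+r∣≤∣p∣+∣q∣+∣r∣ p q r =
    ≤-trans (∣p+q∣≤∣p∣+∣q∣ (p + q) r) (+-monoˡ-≤ ∣ r ∣ (∣p+q∣≤∣p∣+∣q∣ p q))

  ∣p*q∣≤∣q∣ : ∀ {p} q → ∣ p ∣ ≤ 1ℚ → ∣ p * q ∣ ≤ ∣ q ∣
  ∣p*q∣≤∣q∣ {p} q ∣p∣≤1 = begin
    ∣ p * q ∣       ≡⟨ ∣p*q∣≡∣p∣*∣q∣ p q ⟩
    ∣ p ∣ * ∣ q ∣   ≤⟨ *-monoʳ-≤-nonNeg ∣ q ∣ {{∣-∣-nonNeg q}} ∣p∣≤1 ⟩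
    1ℚ * ∣ q ∣      ≡⟨ *-identityˡ ∣ q ∣ ⟩
    ∣ q ∣           ∎
    where open ≤-Reasoning

  p≤q⇒0≤q-p : ∀ {p q} → p ≤ q → 0ℚ ≤ q - p
  p≤q⇒0≤q-p {p} {q} p≤q = subst (_≤ q - p) (+-inverseʳ p) (+-monoˡ-≤ (- p) p≤q)

  r-q≤r-p : ∀ r {p q} → p ≤ q → r - q ≤ r - p
  r-q≤r-p r p≤q = +-monoʳ-≤ r (neg-antimono-≤ p≤q)

  ≤∧≢⇒< : ∀ {p q} → p ≤ q → p ≢ q → p < q
  ≤∧≢⇒< {p} {q} p≤q p≢q with q ≤? p
  ... | yes q≤p = contradiction (≤-antisym p≤q q≤p) p≢q
  ... | no q≰p = ≰⇒> q≰p

  p≢q⇒q-p≢0 : ∀ {p q} → p ≢ q → q - p ≢ 0ℚ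
  p≢q⇒q-p≢0 {p} {q} p≢q q-p≡0 = p≢q (sym (begin
    q             ≡⟨ solve 2 (λ p q → q := q :- p :+ p) refl p q ⟩
    q - p + p     ≡⟨ cong (_+ p) q-p≡0 ⟩
    0ℚ + p        ≡⟨ +-identityˡ p ⟩
    p             ∎))
    where open ≡-Reasoning

  p≢0⇒0<∣p∣ : ∀ {p} → p ≢ 0ℚ → 0ℚ < ∣ p ∣
  p≢0⇒0<∣p∣ {p} p≢0 = ≤∧≢⇒< (0≤∣p∣ p) (λ 0≡∣p∣ → p≢0 (∣p∣≡0⇒p≡0 p (sym 0≡∣p∣)))

  0<p⊓q : ∀ {p q} → 0ℚ < p → 0ℚ < q → 0ℚ < p ⊓ q
  0<p⊓q {p} {q} 0<p 0<q =
    [ (λ e → subst (0ℚ <_) (sym e) 0<p) , (λ e → subst (0ℚ <_) (sym e) 0<q) ]′ (⊓-sel p q)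

  p*q≢0 : ∀ {p q} → p ≢ 0ℚ → q ≢ 0ℚ → p * q ≢ 0ℚ
  p*q≢0 {p} {q} p≢0 q≢0 pq≡0 = q≢0 (begin
    q                ≡⟨ sym (*-identityˡ q) ⟩
    1ℚ * q           ≡⟨ cong (_* q) (sym (*-inverseˡ p)) ⟩
    (1/ p * p) * q   ≡⟨ *-assoc (1/ p) p q ⟩
    1/ p * (p * q)   ≡⟨ cong (1/ p *_) pq≡0 ⟩
    1/ p * 0ℚ        ≡⟨ *-zeroʳ (1/ p) ⟩
    0ℚ               ∎)
    where
    open ≡-Reasoning
    instance
      p-nonZero : NonZero p
      p-nonZero = ≢-nonZero p≢0

  ∣d∣≤a⇒0≤a+d : ∀ {a d} → ∣ d ∣ ≤ a → 0ℚ ≤ a + d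
  ∣d∣≤a⇒0≤a+d {a} {d} ∣d∣≤a =
    subst (_≤ a + d) (+-inverseˡ d) (+-monoˡ-≤ d (≤-trans (-p≤∣p∣ d) ∣d∣≤a))

  ∣d∣≤a⇒0≤a-d : ∀ {a d} → ∣ d ∣ ≤ a → 0ℚ ≤ a - d
  ∣d∣≤a⇒0≤a-d {a} {d} ∣d∣≤a = ∣d∣≤a⇒0≤a+d (subst (_≤ a) (sym (∣-p∣≡∣p∣ d)) ∣d∣≤a)

  ∣p∣≡-p : ∀ {p} → 0ℚ ≤ - p → ∣ p ∣ ≡ - p
  ∣p∣≡-p {p} 0≤-p = trans (sym (∣-p∣≡∣p∣ p)) (0≤p⇒∣p∣≡p 0≤-p)

  -- y + d and y - d have the sign of y, so |.| is affine between them.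
  ∣y∣≡½[∣y+d∣+∣y-d∣] : ∀ {y d} → ∣ d ∣ ≤ ∣ y ∣ → ∣ y ∣ ≡ ½ * (∣ y + d ∣ + ∣ y - d ∣)
  ∣y∣≡½[∣y+d∣+∣y-d∣] {y} {d} ∣d∣≤∣y∣ with ≤-total 0ℚ y
  ... | inj₁ 0≤y = begin
    ∣ y ∣
      ≡⟨ ∣y∣≡y ⟩
    y
      ≡⟨ solve 2 (λ y d → y := con ½ :* ((y :+ d) :+ (y :- d))) refl y d ⟩
    ½ * ((y + d) + (y - d))
      ≡⟨ cong₂ (λ u v → ½ * (u + v)) (sym (0≤p⇒∣p∣≡p 0≤y+d)) (sym (0≤p⇒∣p∣≡p 0≤y-d)) ⟩
    ½ * (∣ y + d ∣ + ∣ y - d ∣)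
      ∎
    where
    open ≡-Reasoning
    ∣y∣≡y : ∣ y ∣ ≡ y
    ∣y∣≡y = 0≤p⇒∣p∣≡p 0≤y
    ∣d∣≤y : ∣ d ∣ ≤ y
    ∣d∣≤y = subst (∣ d ∣ ≤_) ∣y∣≡y ∣d∣≤∣y∣
    0≤y+d : 0ℚ ≤ y + d
    0≤y+d = ∣d∣≤a⇒0≤a+d ∣d∣≤y
    0≤y-d : 0ℚ ≤ y - d
    0≤y-d = ∣d∣≤a⇒0≤a-d ∣d∣≤y
  ... | inj₂ y≤0 = begin
    ∣ y ∣
      ≡⟨ ∣y∣≡-y ⟩
    - y
      ≡⟨ solve 2 (λ y d → :- y := con ½ :* ((:- (y :+ d)) :+ (:- (y :- d)))) refl y d ⟩
    ½ * (- (y + d) + - (y - d))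
      ≡⟨ cong₂ (λ u v → ½ * (u + v)) (sym (∣p∣≡-p 0≤-[y+d])) (sym (∣p∣≡-p 0≤-[y-d])) ⟩
    ½ * (∣ y + d ∣ + ∣ y - d ∣)
      ∎
    where
    open ≡-Reasoning
    ∣y∣≡-y : ∣ y ∣ ≡ - y
    ∣y∣≡-y = ∣p∣≡-p (neg-antimono-≤ y≤0)
    ∣d∣≤-y : ∣ d ∣ ≤ - y
    ∣d∣≤-y = subst (∣ d ∣ ≤_) ∣y∣≡-y ∣d∣≤∣y∣
    0≤-[y+d] : 0ℚ ≤ - (y + d)
    0≤-[y+d] = subst (0ℚ ≤_) (solve 2 (λ y d → :- y :- d := :- (y :+ d)) refl y d) (∣d∣≤a⇒0≤a-d ∣d∣≤-y)
    0≤-[y-d] : 0ℚ ≤ - (y - d)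
    0≤-[y-d] = subst (0ℚ ≤_) (solve 2 (λ y d → :- y :+ d := :- (y :- d)) refl y d) (∣d∣≤a⇒0≤a+d ∣d∣≤-y)

  Σℚ-cong : ∀ {n} {f g : Fin n → ℚ} → (∀ m → f m ≡ g m) → Σℚ f ≡ Σℚ g
  Σℚ-cong {zero}  f≗g = refl
  Σℚ-cong {suc n} f≗g = cong₂ _+_ (f≗g zero) (Σℚ-cong (λ m → f≗g (suc m)))

  Σℚ-0 : ∀ n → Σℚ {n} (λ _ → 0ℚ) ≡ 0ℚ
  Σℚ-0 zero    = refl
  Σℚ-0 (suc n) = cong (0ℚ +_) (Σℚ-0 n)

  Σℚ-+ : ∀ {n} (f g : Fin n → ℚ) → Σℚ (λ m → f m + g m) ≡ Σℚ f + Σℚ g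
  Σℚ-+ {zero}  f g = refl
  Σℚ-+ {suc n} f g = begin
    (f zero + g zero) + Σℚ (λ m → f (suc m) + g (suc m))
      ≡⟨ cong ((f zero + g zero) +_) (Σℚ-+ (λ m → f (suc m)) (λ m → g (suc m))) ⟩
    (f zero + g zero) + (Σℚ (λ m → f (suc m)) + Σℚ (λ m → g (suc m)))
      ≡⟨ solve 4 (λ a b c d → (a :+ b) :+ (c :+ d) := (a :+ c) :+ (b :+ d))
           refl (f zero) (g zero) (Σℚ (λ m → f (suc m))) (Σℚ (λ m → g (suc m))) ⟩
    (f zero + Σℚ (λ m → f (suc m))) + (g zero + Σℚ (λ m → g (suc m)))
      ∎
    where open ≡-Reasoning

  Σℚ-neg : ∀ {n} (f : Fin n → ℚ) → Σℚ (λ m → - f m) ≡ - Σℚ f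
  Σℚ-neg {zero}  f = refl
  Σℚ-neg {suc n} f = trans (cong (- f zero +_) (Σℚ-neg (λ m → f (suc m))))
                           (sym (neg-distrib-+ (f zero) (Σℚ (λ m → f (suc m)))))

  basis : ∀ {n} → Fin n → Fin n → ℚ
  basis zero    zero    = 1ℚ
  basis zero    (suc _) = 0ℚ
  basis (suc _) zero    = 0ℚ
  basis (suc i) (suc m) = basis i m

  basis-diag : ∀ {n} (i : Fin n) → basis i i ≡ 1ℚ
  basis-diag zero    = refl
  basis-diag (suc i) = basis-diag i

  basis-off : ∀ {n} {i m : Fin n} → i ≢ m → basis i m ≡ 0ℚ
  basis-off {i = zero}  {zero}  i≢m = contradiction refl i≢m
  basis-off {i = zero}  {suc m} i≢m = refl
  basis-off {i = suc i} {zero}  i≢m = refl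
  basis-off {i = suc i} {suc m} i≢m = basis-off (λ i≡m → i≢m (cong suc i≡m))

  ∣basis∣≤1 : ∀ {n} (i m : Fin n) → ∣ basis i m ∣ ≤ 1ℚ
  ∣basis∣≤1 zero    zero    = ≤-refl
  ∣basis∣≤1 zero    (suc _) = nonNegative⁻¹ 1ℚ
  ∣basis∣≤1 (suc _) zero    = nonNegative⁻¹ 1ℚ
  ∣basis∣≤1 (suc i) (suc m) = ∣basis∣≤1 i m

  Σℚ-basis : ∀ {n} (i : Fin n) (g : Fin n → ℚ) → Σℚ (λ m → basis i m * g m) ≡ g i
  Σℚ-basis {suc n} zero g = begin
    1ℚ * g zero + Σℚ (λ m → 0ℚ * g (suc m))
      ≡⟨ cong₂ _+_ (*-identityˡ (g zero)) (Σℚ-cong (λ m → *-zeroˡ (g (suc m)))) ⟩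
    g zero + Σℚ {n} (λ _ → 0ℚ)              ≡⟨ cong (g zero +_) (Σℚ-0 n) ⟩
    g zero + 0ℚ                             ≡⟨ +-identityʳ (g zero) ⟩
    g zero                                  ∎
    where open ≡-Reasoning
  Σℚ-basis {suc n} (suc i) g = begin
    0ℚ * g zero + Σℚ (λ m → basis i m * g (suc m))
      ≡⟨ cong₂ _+_ (*-zeroˡ (g zero)) (Σℚ-basis i (λ m → g (suc m))) ⟩
    0ℚ + g (suc i)                                 ≡⟨ +-identityˡ (g (suc i)) ⟩
    g (suc i)                                      ∎
    where open ≡-Reasoning

  record Dependence (a₁ a₂ a₃ b₁ b₂ b₃ : ℚ) : Set where
    field
      l₁ l₂ l₃   : ℚ
      kills-a    : l₁ * a₁ + l₂ * a₂ + l₃ * a₃ ≡ 0ℚ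
      kills-b    : l₁ * b₁ + l₂ * b₂ + l₃ * b₃ ≡ 0ℚ
      nontrivial : l₁ ≢ 0ℚ ⊎ l₂ ≢ 0ℚ ⊎ l₃ ≢ 0ℚ

  -- Cramer: the 2 × 2 minors, unless the first two columns are already dependent.
  dependence : ∀ a₁ a₂ a₃ b₁ b₂ b₃ → Dependence a₁ a₂ a₃ b₁ b₂ b₃
  dependence a₁ a₂ a₃ b₁ b₂ b₃ with a₁ * b₂ - a₂ * b₁ ≟ 0ℚ
  ... | no minor≢0 = record
    { l₁ = a₂ * b₃ - a₃ * b₂ ; l₂ = a₃ * b₁ - a₁ * b₃ ; l₃ = a₁ * b₂ - a₂ * b₁
    ; kills-a = solve 6 (λ a₁ a₂ a₃ b₁ b₂ b₃ →
        (a₂ :* b₃ :- a₃ :* b₂) :* a₁ :+ (a₃ :* b₁ :- a₁ :* b₃) :* a₂ :+ (a₁ :* b₂ :- a₂ :* b₁) :* a₃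
          := con 0ℚ)
        refl a₁ a₂ a₃ b₁ b₂ b₃
    ; kills-b = solve 6 (λ a₁ a₂ a₃ b₁ b₂ b₃ →
        (a₂ :* b₃ :- a₃ :* b₂) :* b₁ :+ (a₃ :* b₁ :- a₁ :* b₃) :* b₂ :+ (a₁ :* b₂ :- a₂ :* b₁) :* b₃
          := con 0ℚ)
        refl a₁ a₂ a₃ b₁ b₂ b₃
    ; nontrivial = inj₂ (inj₂ minor≢0)
    }
  ... | yes minor≡0 with a₁ ≟ 0ℚ | b₁ ≟ 0ℚ
  ...   | no a₁≢0 | _ = record
    { l₁ = - a₂ ; l₂ = a₁ ; l₃ = 0ℚ
    ; kills-a = solve 3 (λ a₁ a₂ a₃ → :- a₂ :* a₁ :+ a₁ :* a₂ :+ con 0ℚ :* a₃ := con 0ℚ) refl a₁ a₂ a₃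
    ; kills-b = trans (solve 5 (λ a₁ a₂ b₁ b₂ b₃ →
                          :- a₂ :* b₁ :+ a₁ :* b₂ :+ con 0ℚ :* b₃ := a₁ :* b₂ :- a₂ :* b₁)
                        refl a₁ a₂ b₁ b₂ b₃) minor≡0
    ; nontrivial = inj₂ (inj₁ a₁≢0)
    }
  ...   | yes a₁≡0 | no b₁≢0 = record
    { l₁ = - b₂ ; l₂ = b₁ ; l₃ = 0ℚ
    ; kills-a = trans (solve 5 (λ a₁ a₂ a₃ b₁ b₂ →
                          :- b₂ :* a₁ :+ b₁ :* a₂ :+ con 0ℚ :* a₃ := :- (a₁ :* b₂ :- a₂ :* b₁))
                        refl a₁ a₂ a₃ b₁ b₂) (cong -_ minor≡0)
    ; kills-b = solve 3 (λ b₁ b₂ b₃ → :- b₂ :* b₁ :+ b₁ :* b₂ :+ con 0ℚ :* b₃ := con 0ℚ) refl b₁ b₂ b₃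
    ; nontrivial = inj₂ (inj₁ b₁≢0)
    }
  ...   | yes a₁≡0 | yes b₁≡0 = record
    { l₁ = 1ℚ ; l₂ = 0ℚ ; l₃ = 0ℚ
    ; kills-a = trans (solve 3 (λ a₁ a₂ a₃ → con 1ℚ :* a₁ :+ con 0ℚ :* a₂ :+ con 0ℚ :* a₃ := a₁)
                        refl a₁ a₂ a₃) a₁≡0
    ; kills-b = trans (solve 3 (λ b₁ b₂ b₃ → con 1ℚ :* b₁ :+ con 0ℚ :* b₂ :+ con 0ℚ :* b₃ := b₁)
                        refl b₁ b₂ b₃) b₁≡0
    ; nontrivial = inj₁ 1≢0
    }

  module _ {a₁ a₂ a₃ b₁ b₂ b₃ : ℚ} where
    open Dependence

    dependence-scale : ∀ c → c ≢ 0ℚ → Dependence a₁ a₂ a₃ b₁ b₂ b₃ → Dependence a₁ a₂ a₃ b₁ b₂ b₃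
    dependence-scale c c≢0 D = record
      { l₁ = c * l₁ D ; l₂ = c * l₂ D ; l₃ = c * l₃ D
      ; kills-a = scaled a₁ a₂ a₃ (kills-a D)
      ; kills-b = scaled b₁ b₂ b₃ (kills-b D)
      ; nontrivial = Sum.map (p*q≢0 c≢0) (Sum.map (p*q≢0 c≢0) (p*q≢0 c≢0)) (nontrivial D)
      }
      where
      scaled : ∀ u₁ u₂ u₃ → l₁ D * u₁ + l₂ D * u₂ + l₃ D * u₃ ≡ 0ℚ →
               c * l₁ D * u₁ + c * l₂ D * u₂ + c * l₃ D * u₃ ≡ 0ℚ
      scaled u₁ u₂ u₃ kills = begin
        c * l₁ D * u₁ + c * l₂ D * u₂ + c * l₃ D * u₃
          ≡⟨ solve 7 (λ c l₁ l₂ l₃ u₁ u₂ u₃ → c :* l₁ :* u₁ :+ c :* l₂ :* u₂ :+ c :* l₃ :* u₃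
                        := c :* (l₁ :* u₁ :+ l₂ :* u₂ :+ l₃ :* u₃)) refl c (l₁ D) (l₂ D) (l₃ D) u₁ u₂ u₃ ⟩
        c * (l₁ D * u₁ + l₂ D * u₂ + l₃ D * u₃) ≡⟨ cong (c *_) kills ⟩
        c * 0ℚ                                  ≡⟨ *-zeroʳ c ⟩
        0ℚ                                      ∎
        where open ≡-Reasoning

    bounded-dependence : Σ[ D ∈ Dependence a₁ a₂ a₃ b₁ b₂ b₃ ] ∣ l₁ D ∣ + ∣ l₂ D ∣ + ∣ l₃ D ∣ ≤ 1ℚ
    bounded-dependence = dependence-scale c c≢0 D , bound
      where
      D : Dependence a₁ a₂ a₃ b₁ b₂ b₃
      D = dependence a₁ a₂ a₃ b₁ b₂ b₃
      N : ℚ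
      N = ∣ l₁ D ∣ + ∣ l₂ D ∣ + ∣ l₃ D ∣
      0≤N : 0ℚ ≤ N
      0≤N = +-mono-≤ (+-mono-≤ (0≤∣p∣ (l₁ D)) (0≤∣p∣ (l₂ D))) (0≤∣p∣ (l₃ D))
      N≤1+N : N ≤ 1ℚ + N
      N≤1+N = subst (_≤ 1ℚ + N) (+-identityˡ N) (+-monoˡ-≤ N (nonNegative⁻¹ 1ℚ))
      0<1+N : 0ℚ < 1ℚ + N
      0<1+N = <-≤-trans (positive⁻¹ 1ℚ) (subst (_≤ 1ℚ + N) (+-identityʳ 1ℚ) (+-monoʳ-≤ 1ℚ 0≤N))
      instance
        1+N-nonZero : NonZero (1ℚ + N)
        1+N-nonZero = pos⇒nonZero (1ℚ + N) {{positive 0<1+N}}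
      c : ℚ
      c = 1/ (1ℚ + N)
      0<c : 0ℚ < c
      0<c = positive⁻¹ c {{1/pos⇒pos (1ℚ + N) {{positive 0<1+N}}}}
      c≢0 : c ≢ 0ℚ
      c≢0 = ≢-sym (<⇒≢ 0<c)
      ∣cl∣≡c∣l∣ : ∀ l → ∣ c * l ∣ ≡ c * ∣ l ∣
      ∣cl∣≡c∣l∣ l = trans (∣p*q∣≡∣p∣*∣q∣ c l) (cong (_* ∣ l ∣) (0≤p⇒∣p∣≡p (<⇒≤ 0<c)))
      bound : ∣ c * l₁ D ∣ + ∣ c * l₂ D ∣ + ∣ c * l₃ D ∣ ≤ 1ℚ
      bound = begin
        ∣ c * l₁ D ∣ + ∣ c * l₂ D ∣ + ∣ c * l₃ D ∣
          ≡⟨ cong₂ _+_ (cong₂ _+_ (∣cl∣≡c∣l∣ (l₁ D)) (∣cl∣≡c∣l∣ (l₂ D))) (∣cl∣≡c∣l∣ (l₃ D)) ⟩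
        c * ∣ l₁ D ∣ + c * ∣ l₂ D ∣ + c * ∣ l₃ D ∣
          ≡⟨ solve 4 (λ c x y z → c :* x :+ c :* y :+ c :* z := c :* (x :+ y :+ z))
               refl c (∣ l₁ D ∣) (∣ l₂ D ∣) (∣ l₃ D ∣) ⟩
        c * N              ≤⟨ *-monoˡ-≤-nonNeg c {{nonNegative (<⇒≤ 0<c)}} N≤1+N ⟩
        c * (1ℚ + N)       ≡⟨ *-inverseˡ (1ℚ + N) ⟩
        1ℚ                 ∎
        where open ≤-Reasoning

  kernel-vector : ∀ {n} (a b : Fin n → ℚ) {i j k : Fin n} → i ≢ j → i ≢ k → j ≢ k →
    ∃[ μ ] (Σℚ (λ m → μ m * a m) ≡ 0ℚ) × (Σℚ (λ m → μ m * b m) ≡ 0ℚ)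
         × (∀ m → ∣ μ m ∣ ≤ 1ℚ) × (μ i ≢ 0ℚ ⊎ μ j ≢ 0ℚ ⊎ μ k ≢ 0ℚ)
  kernel-vector {n} a b {i} {j} {k} i≢j i≢k j≢k =
    μ , trans (Σμ a) kills-a , trans (Σμ b) kills-b , ∣μ∣≤1 ,
    Sum.map (subst (_≢ 0ℚ) (sym μi≡l₁)) (Sum.map (subst (_≢ 0ℚ) (sym μj≡l₂)) (subst (_≢ 0ℚ) (sym μk≡l₃)))
            nontrivial
    where
    D : Dependence (a i) (a j) (a k) (b i) (b j) (b k)
    D = proj₁ (bounded-dependence {a i} {a j} {a k} {b i} {b j} {b k})
    open Dependence D
    Σ∣l∣≤1 : ∣ l₁ ∣ + ∣ l₂ ∣ + ∣ l₃ ∣ ≤ 1ℚ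
    Σ∣l∣≤1 = proj₂ (bounded-dependence {a i} {a j} {a k} {b i} {b j} {b k})

    μ : Fin n → ℚ
    μ m = basis i m * l₁ + basis j m * l₂ + basis k m * l₃

    Σμ : ∀ g → Σℚ (λ m → μ m * g m) ≡ l₁ * g i + l₂ * g j + l₃ * g k
    Σμ g = begin
      Σℚ (λ m → μ m * g m)
        ≡⟨ Σℚ-cong (λ m → solve 7 (λ x y z l₁ l₂ l₃ g →
               (x :* l₁ :+ y :* l₂ :+ z :* l₃) :* g := x :* (l₁ :* g) :+ y :* (l₂ :* g) :+ z :* (l₃ :* g))
             refl (basis i m) (basis j m) (basis k m) l₁ l₂ l₃ (g m)) ⟩
      Σℚ (λ m → f₁ m + f₂ m + f₃ m)             ≡⟨ Σℚ-+ (λ m → f₁ m + f₂ m) f₃ ⟩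
      Σℚ (λ m → f₁ m + f₂ m) + Σℚ f₃            ≡⟨ cong (_+ Σℚ f₃) (Σℚ-+ f₁ f₂) ⟩
      Σℚ f₁ + Σℚ f₂ + Σℚ f₃
        ≡⟨ cong₂ _+_ (cong₂ _+_ (Σℚ-basis i (λ m → l₁ * g m)) (Σℚ-basis j (λ m → l₂ * g m)))
                     (Σℚ-basis k (λ m → l₃ * g m)) ⟩
      l₁ * g i + l₂ * g j + l₃ * g k
        ∎
      where
      open ≡-Reasoning
      f₁ f₂ f₃ : Fin n → ℚ
      f₁ m = basis i m * (l₁ * g m)
      f₂ m = basis j m * (l₂ * g m)
      f₃ m = basis k m * (l₃ * g m)

    ∣μ∣≤1 : ∀ m → ∣ μ m ∣ ≤ 1ℚ
    ∣μ∣≤1 m = begin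
      ∣ μ m ∣
        ≤⟨ ∣p+q+r∣≤∣p∣+∣q∣+∣r∣ (basis i m * l₁) (basis j m * l₂) (basis k m * l₃) ⟩
      ∣ basis i m * l₁ ∣ + ∣ basis j m * l₂ ∣ + ∣ basis k m * l₃ ∣
        ≤⟨ +-mono-≤ (+-mono-≤ (∣p*q∣≤∣q∣ l₁ (∣basis∣≤1 i m)) (∣p*q∣≤∣q∣ l₂ (∣basis∣≤1 j m)))
                    (∣p*q∣≤∣q∣ l₃ (∣basis∣≤1 k m)) ⟩
      ∣ l₁ ∣ + ∣ l₂ ∣ + ∣ l₃ ∣
        ≤⟨ Σ∣l∣≤1 ⟩
      1ℚ ∎
      where open ≤-Reasoning

    μ-at : ∀ {m x y z} → basis i m ≡ x → basis j m ≡ y → basis k m ≡ z → μ m ≡ x * l₁ + y * l₂ + z * l₃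
    μ-at refl refl refl = refl

    μi≡l₁ : μ i ≡ l₁
    μi≡l₁ = trans (μ-at (basis-diag i) (basis-off (≢-sym i≢j)) (basis-off (≢-sym i≢k)))
                  (solve 3 (λ x y z → con 1ℚ :* x :+ con 0ℚ :* y :+ con 0ℚ :* z := x) refl l₁ l₂ l₃)
    μj≡l₂ : μ j ≡ l₂
    μj≡l₂ = trans (μ-at (basis-off i≢j) (basis-diag j) (basis-off (≢-sym j≢k)))
                  (solve 3 (λ x y z → con 0ℚ :* x :+ con 1ℚ :* y :+ con 0ℚ :* z := y) refl l₁ l₂ l₃)
    μk≡l₃ : μ k ≡ l₃
    μk≡l₃ = trans (μ-at (basis-off i≢k) (basis-off j≢k) (basis-diag k))
                  (solve 3 (λ x y z → con 0ℚ :* x :+ con 0ℚ :* y :+ con 1ℚ :* z := z) refl l₁ l₂ l₃)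

  Interior : ℚ → Set
  Interior a = 0ℚ < a × a < 1ℚ

  Open : ℚ → ℚ → Set
  Open a b = Interior a ⊎ Interior b

  open? : ∀ a b → Dec (Open a b)
  open? a b = ((0ℚ <? a) ×-dec (a <? 1ℚ)) ⊎-dec ((0ℚ <? b) ×-dec (b <? 1ℚ))

  ¬interior⇒0∨1 : ∀ {a} → InUnit a → ¬ Interior a → a ≡ 0ℚ ⊎ a ≡ 1ℚ
  ¬interior⇒0∨1 {a} (0≤a , a≤1) ¬interior with 0ℚ ≟ a | a ≟ 1ℚ
  ... | yes 0≡a | _       = inj₁ (sym 0≡a)
  ... | no _    | yes a≡1 = inj₂ a≡1
  ... | no 0≢a  | no a≢1  = contradiction (≤∧≢⇒< 0≤a 0≢a , ≤∧≢⇒< a≤1 a≢1) ¬interior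

  ¬open⇒integral : ∀ {a b} → InUnit a → InUnit b → ¬ Open a b →
    IsInteger a × IsInteger b × IsInteger (1ℚ - ∣ b - a ∣)
  ¬open⇒integral ua ub ¬open with ¬interior⇒0∨1 ua (¬open ∘ inj₁) | ¬interior⇒0∨1 ub (¬open ∘ inj₂)
  ... | inj₁ refl | inj₁ refl = (0ℤ , refl) , (0ℤ , refl) , (1ℤ , refl)
  ... | inj₁ refl | inj₂ refl = (0ℤ , refl) , (1ℤ , refl) , (0ℤ , refl)
  ... | inj₂ refl | inj₁ refl = (1ℤ , refl) , (0ℤ , refl) , (0ℤ , refl)
  ... | inj₂ refl | inj₂ refl = (1ℤ , refl) , (1ℤ , refl) , (1ℤ , refl)

  fractional⇒open : ∀ {a b} → InUnit a → InUnit b →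
    ¬ IsInteger a ⊎ ¬ IsInteger b ⊎ ¬ IsInteger (1ℚ - ∣ b - a ∣) → Open a b
  fractional⇒open {a} {b} ua ub fractional with open? a b
  ... | yes open-ab = open-ab
  ... | no ¬open    =
    let ia , ib , iz = ¬open⇒integral ua ub ¬open
    in ⊥-elim ([ _$ ia , [ _$ ib , _$ iz ]′ ]′ fractional)

  b-a≤1 : ∀ {a b} → InUnit a → InUnit b → b - a ≤ 1ℚ
  b-a≤1 (0≤a , _) (_ , b≤1) = +-mono-≤ b≤1 (neg-antimono-≤ 0≤a)

  ∣b-a∣≤1 : ∀ {a b} → InUnit a → InUnit b → ∣ b - a ∣ ≤ 1ℚ
  ∣b-a∣≤1 {a} {b} ua ub =
    ∣p∣≤q (b-a≤1 ua ub) (subst (_≤ 1ℚ) (solve 2 (λ a b → a :- b := :- (b :- a)) refl a b) (b-a≤1 ub ua))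

  tight-z-feasible : ∀ {a b} → InUnit a → InUnit b →
    InUnit (1ℚ - ∣ b - a ∣) × (1ℚ - ∣ b - a ∣ ≤ (0ℚ - b) + a + 1ℚ) × (1ℚ - ∣ b - a ∣ ≤ b - a + 1ℚ)
  tight-z-feasible {a} {b} ua ub =
    (p≤q⇒0≤q-p (∣b-a∣≤1 ua ub) , r-q≤r-p 1ℚ (0≤∣p∣ (b - a))) ,
    subst (1ℚ - ∣ b - a ∣ ≤_) (solve 2 (λ a b → con 1ℚ :- (b :- a) := (con 0ℚ :- b) :+ a :+ con 1ℚ) refl a b)
          (r-q≤r-p 1ℚ (p≤∣p∣ (b - a))) ,
    subst (1ℚ - ∣ b - a ∣ ≤_) (solve 2 (λ a b → con 1ℚ :- (:- (b :- a)) := b :- a :+ con 1ℚ) refl a b)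
          (r-q≤r-p 1ℚ (-p≤∣p∣ (b - a)))

  tight-z-midpoint : ∀ {a b d₁ d₂} → ∣ d₂ - d₁ ∣ ≤ ∣ b - a ∣ →
    1ℚ - ∣ b - a ∣ ≡ ½ * ((1ℚ - ∣ (b + d₂) - (a + d₁) ∣) + (1ℚ - ∣ (b - d₂) - (a - d₁) ∣))
  tight-z-midpoint {a} {b} {d₁} {d₂} keeps-sign = begin
    1ℚ - ∣ b - a ∣
      ≡⟨ cong (λ u → 1ℚ - u) (∣y∣≡½[∣y+d∣+∣y-d∣] keeps-sign) ⟩
    1ℚ - ½ * (∣ (b - a) + (d₂ - d₁) ∣ + ∣ (b - a) - (d₂ - d₁) ∣)
      ≡⟨ solve 2 (λ u v → con 1ℚ :- con ½ :* (u :+ v) := con ½ :* ((con 1ℚ :- u) :+ (con 1ℚ :- v)))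
           refl (∣ (b - a) + (d₂ - d₁) ∣) (∣ (b - a) - (d₂ - d₁) ∣) ⟩
    ½ * ((1ℚ - ∣ (b - a) + (d₂ - d₁) ∣) + (1ℚ - ∣ (b - a) - (d₂ - d₁) ∣))
      ≡⟨ cong₂ (λ u v → ½ * ((1ℚ - ∣ u ∣) + (1ℚ - ∣ v ∣)))
           (solve 4 (λ a b d₁ d₂ → (b :- a) :+ (d₂ :- d₁) := (b :+ d₂) :- (a :+ d₁)) refl a b d₁ d₂)
           (solve 4 (λ a b d₁ d₂ → (b :- a) :- (d₂ :- d₁) := (b :- d₂) :- (a :- d₁)) refl a b d₁ d₂) ⟩
    ½ * ((1ℚ - ∣ (b + d₂) - (a + d₁) ∣) + (1ℚ - ∣ (b - d₂) - (a - d₁) ∣))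
      ∎
    where open ≡-Reasoning

  Slack : ℚ → ℚ → Set
  Slack a d = ∣ d ∣ ≤ a × ∣ d ∣ ≤ 1ℚ - a

  slack⇒InUnit : ∀ {a d} → Slack a d → InUnit (a + d)
  slack⇒InUnit {a} {d} (∣d∣≤a , ∣d∣≤1-a) =
    ∣d∣≤a⇒0≤a+d ∣d∣≤a ,
    subst (a + d ≤_) (solve 1 (λ a → a :+ (con 1ℚ :- a) := con 1ℚ) refl a)
          (+-monoʳ-≤ a (≤-trans (p≤∣p∣ d) ∣d∣≤1-a))

  slack-zero : ∀ {a} → InUnit a → Slack a 0ℚ
  slack-zero (0≤a , a≤1) = 0≤a , p≤q⇒0≤q-p a≤1

  slack-neg : ∀ {a d} → Slack a d → Slack a (- d)
  slack-neg {d = d} = subst (λ e → e ≤ _ × e ≤ _) (sym (∣-p∣≡∣p∣ d))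

  slack-scale : ∀ {a d μ} → ∣ μ ∣ ≤ 1ℚ → Slack a d → Slack a (μ * d)
  slack-scale {d = d} ∣μ∣≤1 (∣d∣≤a , ∣d∣≤1-a) =
    ≤-trans (∣p*q∣≤∣q∣ d ∣μ∣≤1) ∣d∣≤a , ≤-trans (∣p*q∣≤∣q∣ d ∣μ∣≤1) ∣d∣≤1-a

  -- The last condition keeps the sign of b - a along the move, so 1 - |b - a| is affine there.
  Shift : ℚ → ℚ → ℚ → ℚ → Set
  Shift a b d₁ d₂ = Slack a d₁ × Slack b d₂ × ∣ d₂ - d₁ ∣ ≤ ∣ b - a ∣

  shift-zero : ∀ {a b} → InUnit a → InUnit b → Shift a b 0ℚ 0ℚ
  shift-zero {a} {b} ua ub = slack-zero ua , slack-zero ub , 0≤∣p∣ (b - a)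

  shift-neg : ∀ {a b d₁ d₂} → Shift a b d₁ d₂ → Shift a b (- d₁) (- d₂)
  shift-neg {a} {b} {d₁} {d₂} (s₁ , s₂ , keeps-sign) =
    slack-neg s₁ , slack-neg s₂ ,
    (begin
      ∣ - d₂ - - d₁ ∣   ≡⟨ cong ∣_∣ (sym (neg-distrib-+ d₂ (- d₁))) ⟩
      ∣ - (d₂ - d₁) ∣   ≡⟨ ∣-p∣≡∣p∣ (d₂ - d₁) ⟩
      ∣ d₂ - d₁ ∣       ≤⟨ keeps-sign ⟩
      ∣ b - a ∣         ∎)
    where open ≤-Reasoning

  shift-scale : ∀ {a b d₁ d₂ μ} → ∣ μ ∣ ≤ 1ℚ → Shift a b d₁ d₂ → Shift a b (μ * d₁) (μ * d₂)
  shift-scale {a} {b} {d₁} {d₂} {μ} ∣μ∣≤1 (s₁ , s₂ , keeps-sign) =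
    slack-scale ∣μ∣≤1 s₁ , slack-scale ∣μ∣≤1 s₂ ,
    (begin
      ∣ μ * d₂ - μ * d₁ ∣ ≡⟨ cong ∣_∣ (solve 3 (λ μ x y → μ :* y :- μ :* x := μ :* (y :- x)) refl μ d₁ d₂) ⟩
      ∣ μ * (d₂ - d₁) ∣   ≤⟨ ∣p*q∣≤∣q∣ (d₂ - d₁) ∣μ∣≤1 ⟩
      ∣ d₂ - d₁ ∣         ≤⟨ keeps-sign ⟩
      ∣ b - a ∣           ∎)
    where open ≤-Reasoning

  shift-swap : ∀ {a b d₁ d₂} → Shift a b d₁ d₂ → Shift b a d₂ d₁
  shift-swap {a} {b} {d₁} {d₂} (s₁ , s₂ , keeps-sign) =
    s₂ , s₁ , subst₂ _≤_ (∣p-q∣≡∣q-p∣ d₂ d₁) (∣p-q∣≡∣q-p∣ b a) keeps-sign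

  interior-slack : ∀ {a c} → Interior a → 0ℚ < c → ∃[ δ ] 0ℚ < δ × δ ≤ c × Slack a δ
  interior-slack {a} {c} (0<a , a<1) 0<c =
    δ , 0<δ , p⊓q≤q (a ⊓ (1ℚ - a)) c ,
    subst (_≤ a) (sym ∣δ∣≡δ) (≤-trans (p⊓q≤p _ c) (p⊓q≤p a _)) ,
    subst (_≤ 1ℚ - a) (sym ∣δ∣≡δ) (≤-trans (p⊓q≤p _ c) (p⊓q≤q a _))
    where
    δ : ℚ
    δ = a ⊓ (1ℚ - a) ⊓ c
    0<δ : 0ℚ < δ
    0<δ = 0<p⊓q (0<p⊓q 0<a (subst (_< 1ℚ - a) (+-inverseʳ a) (+-monoˡ-< (- a) a<1))) 0<c
    ∣δ∣≡δ : ∣ δ ∣ ≡ δ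
    ∣δ∣≡δ = 0≤p⇒∣p∣≡p (<⇒≤ 0<δ)

  -- If a = b both coordinates move together; otherwise only the interior one moves,
  -- by less than |b - a| so that the order of a and b is kept.
  open⇒shift : ∀ {a b} → InUnit a → InUnit b → Open a b →
    ∃[ d₁ ] ∃[ d₂ ] Shift a b d₁ d₂ × (d₁ ≢ 0ℚ ⊎ d₂ ≢ 0ℚ)
  open⇒shift {a} {b} ua ub (inj₁ interior-a) with a ≟ b
  ... | yes refl =
    let δ , 0<δ , _ , slack = interior-slack interior-a (positive⁻¹ 1ℚ)
    in δ , δ , (slack , slack , ≤-reflexive (cong ∣_∣ (trans (+-inverseʳ δ) (sym (+-inverseʳ a))))) ,
       inj₁ (≢-sym (<⇒≢ 0<δ))
  ... | no a≢b =
    let δ , 0<δ , δ≤∣b-a∣ , slack = interior-slack interior-a (p≢0⇒0<∣p∣ (p≢q⇒q-p≢0 a≢b))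
    in δ , 0ℚ , (slack , slack-zero ub , keeps-sign δ 0<δ δ≤∣b-a∣) , inj₁ (≢-sym (<⇒≢ 0<δ))
    where
    keeps-sign : ∀ δ → 0ℚ < δ → δ ≤ ∣ b - a ∣ → ∣ 0ℚ - δ ∣ ≤ ∣ b - a ∣
    keeps-sign δ 0<δ δ≤∣b-a∣ = begin
      ∣ 0ℚ - δ ∣   ≡⟨ cong ∣_∣ (+-identityˡ (- δ)) ⟩
      ∣ - δ ∣      ≡⟨ ∣-p∣≡∣p∣ δ ⟩
      ∣ δ ∣        ≡⟨ 0≤p⇒∣p∣≡p (<⇒≤ 0<δ) ⟩
      δ            ≤⟨ δ≤∣b-a∣ ⟩
      ∣ b - a ∣    ∎
      where open ≤-Reasoning
  open⇒shift ua ub (inj₂ interior-b) =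
    let d₂ , d₁ , shift , moves = open⇒shift ub ua (inj₁ interior-b)
    in d₁ , d₂ , shift-swap shift , Sum.swap moves

  record Direction (a b : ℚ) : Set where
    field
      d₁ d₂         : ℚ
      admissible    : Shift a b d₁ d₂
      moves-if-open : Open a b → d₁ ≢ 0ℚ ⊎ d₂ ≢ 0ℚ

  direction : ∀ {a b} → InUnit a → InUnit b → Direction a b
  direction {a} {b} ua ub with open? a b
  ... | yes open-ab =
    let d₁ , d₂ , shift , moves = open⇒shift ua ub open-ab
    in record { d₁ = d₁ ; d₂ = d₂ ; admissible = shift ; moves-if-open = λ _ → moves }
  ... | no ¬open = record
    { d₁ = 0ℚ ; d₂ = 0ℚ ; admissible = shift-zero ua ub
    ; moves-if-open = λ open-ab → contradiction open-ab ¬open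
    }

  tight : ∀ {n} → (Fin n → ℚ) → (Fin n → ℚ) → Point n
  tight y₁ y₂ = point y₁ y₂ (λ m → 1ℚ - ∣ y₂ m - y₁ m ∣)

  Tight : ∀ {n} → Point n → Set
  Tight S = ∀ m → z S m ≡ 1ℚ - ∣ x₂ S m - x₁ S m ∣

  Σℚ-shift : ∀ {n} (w y Δ : Fin n → ℚ) → Σℚ (λ m → w m * Δ m) ≡ 0ℚ →
    Σℚ (λ m → w m * (y m + Δ m)) ≡ Σℚ (λ m → w m * y m)
  Σℚ-shift w y Δ ΣwΔ≡0 = begin
    Σℚ (λ m → w m * (y m + Δ m))                  ≡⟨ Σℚ-cong (λ m → *-distribˡ-+ (w m) (y m) (Δ m)) ⟩
    Σℚ (λ m → w m * y m + w m * Δ m)              ≡⟨ Σℚ-+ (λ m → w m * y m) (λ m → w m * Δ m) ⟩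
    Σℚ (λ m → w m * y m) + Σℚ (λ m → w m * Δ m)   ≡⟨ cong (Σℚ (λ m → w m * y m) +_) ΣwΔ≡0 ⟩
    Σℚ (λ m → w m * y m) + 0ℚ                     ≡⟨ +-identityʳ _ ⟩
    Σℚ (λ m → w m * y m)                          ∎
    where open ≡-Reasoning

  Σℚ-neg-≡0 : ∀ {n} (w Δ : Fin n → ℚ) → Σℚ (λ m → w m * Δ m) ≡ 0ℚ → Σℚ (λ m → w m * - Δ m) ≡ 0ℚ
  Σℚ-neg-≡0 w Δ ΣwΔ≡0 = begin
    Σℚ (λ m → w m * - Δ m)     ≡⟨ Σℚ-cong (λ m → sym (neg-distribʳ-* (w m) (Δ m))) ⟩
    Σℚ (λ m → - (w m * Δ m))   ≡⟨ Σℚ-neg (λ m → w m * Δ m) ⟩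
    - Σℚ (λ m → w m * Δ m)     ≡⟨ cong -_ ΣwΔ≡0 ⟩
    0ℚ                         ∎
    where open ≡-Reasoning

  p+q≡p-q⇒q≡0 : ∀ {p q} → p + q ≡ p - q → q ≡ 0ℚ
  p+q≡p-q⇒q≡0 {p} {q} p+q≡p-q = begin
    q                       ≡⟨ solve 2 (λ p q → q := con ½ :* ((p :+ q) :- (p :- q))) refl p q ⟩
    ½ * ((p + q) - (p - q)) ≡⟨ cong (λ u → ½ * (u - (p - q))) p+q≡p-q ⟩
    ½ * ((p - q) - (p - q)) ≡⟨ cong (½ *_) (+-inverseʳ (p - q)) ⟩
    0ℚ                      ∎
    where open ≡-Reasoning

  module _ {n} (I : Instance n) where
    open Instance I

    tight-feasible : ∀ {y₁ y₂ : Fin n → ℚ} → (∀ m → InUnit (y₁ m) × InUnit (y₂ m)) →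
      Σℚ (λ m → w₁ m * y₁ m) ≤ C₁ → Σℚ (λ m → w₂ m * y₂ m) ≤ C₂ → Feasible I (tight y₁ y₂)
    tight-feasible units knapsack₁ knapsack₂ =
      (λ m → let u₁ , u₂ = units m in u₁ , u₂ , proj₁ (tight-z-feasible u₁ u₂)) ,
      knapsack₁ , knapsack₂ ,
      (λ m → let u₁ , u₂ = units m in proj₂ (tight-z-feasible u₁ u₂))

    shifted-feasible : ∀ {S : Point n} {Δ₁ Δ₂ : Fin n → ℚ} → Feasible I S →
      (∀ m → Shift (x₁ S m) (x₂ S m) (Δ₁ m) (Δ₂ m)) →
      Σℚ (λ m → w₁ m * Δ₁ m) ≡ 0ℚ → Σℚ (λ m → w₂ m * Δ₂ m) ≡ 0ℚ →
      Feasible I (tight (λ m → x₁ S m + Δ₁ m) (λ m → x₂ S m + Δ₂ m))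
    shifted-feasible {S} {Δ₁} {Δ₂} (_ , knapsack₁ , knapsack₂ , _) shift Σ₁≡0 Σ₂≡0 =
      tight-feasible
        (λ m → let slack₁ , slack₂ , _ = shift m in slack⇒InUnit slack₁ , slack⇒InUnit slack₂)
        (subst (_≤ C₁) (sym (Σℚ-shift w₁ (x₁ S) Δ₁ Σ₁≡0)) knapsack₁)
        (subst (_≤ C₂) (sym (Σℚ-shift w₂ (x₂ S) Δ₂ Σ₂≡0)) knapsack₂)

    shift⇒¬basic : ∀ {S : Point n} {Δ₁ Δ₂ : Fin n → ℚ} → Feasible I S → Tight S →
      (∀ m → Shift (x₁ S m) (x₂ S m) (Δ₁ m) (Δ₂ m)) →
      Σℚ (λ m → w₁ m * Δ₁ m) ≡ 0ℚ → Σℚ (λ m → w₂ m * Δ₂ m) ≡ 0ℚ →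
      ∀ t → Δ₁ t ≢ 0ℚ ⊎ Δ₂ t ≢ 0ℚ → ¬ Basic I S
    shift⇒¬basic {S} {Δ₁} {Δ₂} feasible tight-S shift Σ₁≡0 Σ₂≡0 t moves (_ , extreme) =
      extreme S⁺ S⁻ (shifted-feasible feasible shift Σ₁≡0 Σ₂≡0)
                    (shifted-feasible feasible (shift-neg ∘ shift) (Σℚ-neg-≡0 w₁ Δ₁ Σ₁≡0) (Σℚ-neg-≡0 w₂ Δ₂ Σ₂≡0))
                    distinct midpoint
      where
      S⁺ S⁻ : Point n
      S⁺ = tight (λ m → x₁ S m + Δ₁ m) (λ m → x₂ S m + Δ₂ m)
      S⁻ = tight (λ m → x₁ S m - Δ₁ m) (λ m → x₂ S m - Δ₂ m)

      distinct : ¬ SamePoint S⁺ S⁻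
      distinct same = let same₁ , same₂ , _ = same t in
        [ contradiction (p+q≡p-q⇒q≡0 {x₁ S t} same₁) , contradiction (p+q≡p-q⇒q≡0 {x₂ S t} same₂) ]′ moves

      x≡½[[x+d]+[x-d]] : ∀ x d → x ≡ ½ * ((x + d) + (x - d))
      x≡½[[x+d]+[x-d]] = solve 2 (λ x d → x := con ½ :* ((x :+ d) :+ (x :- d))) refl

      midpoint : IsMidpoint S S⁺ S⁻
      midpoint m =
        x≡½[[x+d]+[x-d]] (x₁ S m) (Δ₁ m) , x≡½[[x+d]+[x-d]] (x₂ S m) (Δ₂ m) ,
        trans (tight-S m) (tight-z-midpoint {x₁ S m} {x₂ S m} (proj₂ (proj₂ (shift m))))

    fractional⇒open-at : ∀ {S : Point n} → Feasible I S → Tight S → ∀ m → Fractional S m → Open (x₁ S m) (x₂ S m)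
    fractional⇒open-at {S} feasible tight-S m fractional =
      let u₁ , u₂ , _ = proj₁ feasible m
      in fractional⇒open u₁ u₂ (subst (λ ζ → ¬ IsInteger (x₁ S m) ⊎ ¬ IsInteger (x₂ S m) ⊎ ¬ IsInteger ζ)
                                       (tight-S m) fractional)

    open Direction

    scaled-directions⇒¬basic : ∀ {S : Point n} → Feasible I S → Tight S →
      (dir : ∀ m → Direction (x₁ S m) (x₂ S m)) (μ : Fin n → ℚ) → (∀ m → ∣ μ m ∣ ≤ 1ℚ) →
      Σℚ (λ m → μ m * (w₁ m * d₁ (dir m))) ≡ 0ℚ → Σℚ (λ m → μ m * (w₂ m * d₂ (dir m))) ≡ 0ℚ →
      ∀ t → μ t ≢ 0ℚ → Open (x₁ S t) (x₂ S t) → ¬ Basic I S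
    scaled-directions⇒¬basic feasible tight-S dir μ ∣μ∣≤1 Σ₁≡0 Σ₂≡0 t μt≢0 open-t =
      shift⇒¬basic feasible tight-S (λ m → shift-scale (∣μ∣≤1 m) (admissible (dir m)))
        (trans (Σℚ-cong (λ m → w*[μ*d]≡μ*[w*d] (w₁ m) (μ m) (d₁ (dir m)))) Σ₁≡0)
        (trans (Σℚ-cong (λ m → w*[μ*d]≡μ*[w*d] (w₂ m) (μ m) (d₂ (dir m)))) Σ₂≡0)
        t (Sum.map (p*q≢0 μt≢0) (p*q≢0 μt≢0) (moves-if-open (dir t) open-t))
      where
      w*[μ*d]≡μ*[w*d] : ∀ w μ d → w * (μ * d) ≡ μ * (w * d)
      w*[μ*d]≡μ*[w*d] = solve 3 (λ w μ d → w :* (μ :* d) := μ :* (w :* d)) refl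

    three-open⇒¬basic : ∀ {S : Point n} → Feasible I S → Tight S → ∀ {i j k} → i ≢ j → i ≢ k → j ≢ k →
      Open (x₁ S i) (x₂ S i) → Open (x₁ S j) (x₂ S j) → Open (x₁ S k) (x₂ S k) → ¬ Basic I S
    three-open⇒¬basic {S} feasible tight-S {i} {j} {k} i≢j i≢k j≢k open-i open-j open-k =
      let μ , Σ₁≡0 , Σ₂≡0 , ∣μ∣≤1 , μ≢0 =
            kernel-vector (λ m → w₁ m * d₁ (dir m)) (λ m → w₂ m * d₂ (dir m)) i≢j i≢k j≢k
          ¬basic-moving t = scaled-directions⇒¬basic feasible tight-S dir μ ∣μ∣≤1 Σ₁≡0 Σ₂≡0 t
      in [ flip (¬basic-moving i) open-i
         , [ flip (¬basic-moving j) open-j , flip (¬basic-moving k) open-k ]′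
         ]′ μ≢0
      where
      dir : ∀ m → Direction (x₁ S m) (x₂ S m)
      dir m = let u₁ , u₂ , _ = proj₁ feasible m in direction u₁ u₂

open import Data.Nat using (ℕ; _≤_; z≤n; s≤s)
open import Data.Nat.Properties using (≤-trans)
open import Data.Empty using (⊥; ⊥-elim)
open import Data.List using ([]; _∷_; filter; allFin)
open import Data.List.Membership.Propositional.Properties using (∈-filter⁺; ∈-allFin)
open import Data.List.Relation.Unary.All using (All; _∷_)
open import Data.List.Relation.Unary.All.Properties using (all-filter)
open import Data.List.Relation.Unary.AllPairs using (_∷_)
open import Data.List.Relation.Unary.Unique.Propositional using (Unique)
open import Data.List.Relation.Unary.Unique.Propositional.Properties using (allFin⁺; filter⁺)
open import Data.Product using (_,_)
open import Relation.Nullary using (Dec)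
open import Relation.Binary.PropositionalEquality using (_≢_)
open Perturbation using (Open; open?; Tight; fractional⇒open-at; three-open⇒¬basic)

unique⇒length≤2 : ∀ {A : Set} {P : A → Set} (xs : List A) → Unique xs → All P xs →
  (∀ {a b c} → a ≢ b → a ≢ c → b ≢ c → P a → P b → P c → ⊥) → length xs ≤ 2
unique⇒length≤2 []              _ _ _ = z≤n
unique⇒length≤2 (_ ∷ [])        _ _ _ = s≤s z≤n
unique⇒length≤2 (_ ∷ _ ∷ [])    _ _ _ = s≤s (s≤s z≤n)
unique⇒length≤2 (_ ∷ _ ∷ _ ∷ _) ((a≢b ∷ a≢c ∷ _) ∷ (b≢c ∷ _) ∷ _) (pa ∷ pb ∷ pc ∷ _) no-three =
  ⊥-elim (no-three a≢b a≢c b≢c pa pb pc)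

open-at? : ∀ {n} (S : Point n) m → Dec (Open (x₁ S m) (x₂ S m))
open-at? S m = open? (x₁ S m) (x₂ S m)

open-objects : ∀ {n} → Point n → List (Fin n)
open-objects {n} S = filter (open-at? S) (allFin n)

length-open-objects≤2 : ∀ {n} (I : Instance n) {S : Point n} → Feasible I S → Tight S → Basic I S →
  length (open-objects S) ≤ 2
length-open-objects≤2 {n} I {S} feasible tight-S basic =
  unique⇒length≤2 (open-objects S) (filter⁺ (open-at? S) (allFin⁺ n)) (all-filter (open-at? S) (allFin n))
    (λ i≢j i≢k j≢k open-i open-j open-k →
       three-open⇒¬basic I feasible tight-S i≢j i≢k j≢k open-i open-j open-k basic)

fractional∈open-objects : ∀ {n} (I : Instance n) {S : Point n} → Feasible I S → Tight S →
  ∀ i → Fractional S i → i ∈ open-objects S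
fractional∈open-objects I {S} feasible tight-S i fractional =
  ∈-filter⁺ (open-at? S) (∈-allFin i) (fractional⇒open-at I feasible tight-S i fractional)

proposition1 : (n : ℕ) (I : Instance n) (S : Point n) →
    Feasible I S →
    ((i : Fin n) → z S i ≡ 1ℚ - ∣ x₂ S i - x₁ S i ∣) →
    Basic I S →
    ∃[ L ] ((length L ≤ 4) × ((i : Fin n) → Fractional S i → i ∈ L))
proposition1 n I S feasible tight-S basic =
  open-objects S ,
  ≤-trans (length-open-objects≤2 I feasible tight-S basic) (s≤s (s≤s z≤n)) ,
  fractional∈open-objects I feasible tight-S
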